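{- Let $G=(V,E,\le)$ be a base graph, $q\ge1$ and $g\colon E\to\mathbb{Z}_{2^q}$. The automorphism group of $\mathsf{CFI}_{2^q}(G,g)$ is an abelian $2$-group.
   Context: A base graph is a finite simple connected graph $G=(V,E)$ with a total order $\le$ on $V$. $\mathsf{CFI}_{2^q}(G,g)$ has universe the disjoint union of $A_x=\{\bar a\in\mathbb{Z}_{2^q}^{N_G(x)}:\sum\bar a=0\}$, $x\in V$; binary relations $R_{E,c}=\bigcup_{e\in E}E_{e,c+g(e)}$ for $c\in\mathbb{Z}_{2^q}$, where $E_{\{x,y\},c}=\{\{\bar a,\bar b\}:\bar a\in A_x,\bar b\in A_y,\bar a(y)+\bar b(x)=c\}$; the total preorder $\preceq=\{(\bar a,\bar b):\bar a\in A_x,\bar b\in A_y,x\le y\}$; and 4-ary relations $R_I,R_C$ which encode (using the order on $V$) the relations $I_{x,y}=\{(\bar a,\bar b)\in A_x^2:\bar a(y)=\bar b(y)\}$ and $C_{x,y}=\{(\bar a,\bar b)\in A_x^2:\bar a(y)+1=\bar b(y)\}$ for $x\in V$, $y\in N_G(x)$, in such a way that each $I_{x,y}$ and $C_{x,y}$ is recoverable. A $2$-group is a group all of whose elements have order a power of $2$. -}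

module Defs where

open import Data.Nat using (ℕ; zero; suc; _+_; _^_; _≥_; NonZero)
open import Data.Nat.Properties using (m^n≢0)
open import Data.Nat.DivMod using (_mod_)
open import Data.Fin using (Fin; toℕ) renaming (_≤_ to _≤ᶠ_; _≟_ to _≟ᶠ_)
open import Data.Vec using (Vec; lookup; foldr; tabulate)
open import Data.Bool using (Bool; true; false; T; _∧_; not)
open import Data.Product using (Σ; Σ-syntax; ∃; _×_; _,_; proj₁; proj₂)
open import Relation.Nullary using (¬_)
open import Relation.Nullary.Decidable using (⌊_⌋)
open import Relation.Binary.PropositionalEquality using (_≡_)
open import Function using (_∘_; id)

-- Base graphs.  Vertices are Fin n, the total order on V is the
-- natural order of Fin n (every finite total order is of this form).
-- Edges are given by a Boolean adjacency matrix.

data Walk {n : ℕ} (adj : Fin n → Fin n → Bool) : Fin n → Fin n → Set where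
  here : ∀ {x} → Walk adj x x
  step : ∀ {x y z} → T (adj x y) → Walk adj y z → Walk adj x z

record BaseGraph (n : ℕ) : Set where
  field
    adj       : Fin n → Fin n → Bool
    irrefl    : ∀ x → ¬ T (adj x x)
    sym       : ∀ x y → adj x y ≡ adj y x
    connected : ∀ x y → Walk adj x y

Mod : ℕ → ℕ
Mod q = 2 ^ q


Zq : ℕ → Set
Zq q = Fin (Mod q)

addZ : ∀ q → Zq q → Zq q → Zq q
addZ q a b = ((toℕ a + toℕ b) mod (Mod q)) {{m^n≢0 2 q}}

zeroZ : ∀ q → Zq q
zeroZ q = (0 mod (Mod q)) {{m^n≢0 2 q}}

oneZ : ∀ q → Zq q
oneZ q = (1 mod (Mod q)) {{m^n≢0 2 q}}

sumZ : ∀ q {m} → Vec (Zq q) m → Zq q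
sumZ q = foldr _ (addZ q) (zeroZ q)

-- The CFI structure CFI_{2^q}(G, g).
-- g : E → Z_{2^q} is given as a function on ordered pairs that is
-- required (in the theorem) to be symmetric; only its values on edges matter.

module CFI {n : ℕ} (G : BaseGraph n) (q : ℕ) (g : Fin n → Fin n → Zq q) where
  open BaseGraph G

  -- a ∈ Z^{N(x)} is represented by a vector in Z^V that is 0 outside N(x)
  valid : Fin n → Vec (Zq q) n → Bool
  valid x a = ⌊ sumZ q a ≟ᶠ zeroZ q ⌋
            ∧ Data.Vec.foldr _ _∧_ true
                (tabulate (λ y → adj x y ∨' ⌊ lookup a y ≟ᶠ zeroZ q ⌋))
    where
      _∨'_ : Bool → Bool → Bool
      true ∨' _ = true
      false ∨' b = b

  U : Set
  U = Σ[ x ∈ Fin n ] Σ[ a ∈ Vec (Zq q) n ] T (valid x a)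

  vert : U → Fin n
  vert = proj₁

  vec : U → Vec (Zq q) n
  vec u = proj₁ (proj₂ u)

  RE : Zq q → U → U → Set
  RE c u v = T (adj (vert u) (vert v))
           × (addZ q (lookup (vec u) (vert v)) (lookup (vec v) (vert u))
               ≡ addZ q c (g (vert u) (vert v)))

  Pre : U → U → Set
  Pre u v = vert u ≤ᶠ vert v

  I : Fin n → Fin n → U → U → Set
  I x y u v = vert u ≡ x × vert v ≡ x × lookup (vec u) y ≡ lookup (vec v) y

  C : Fin n → Fin n → U → U → Set
  C x y u v = vert u ≡ x × vert v ≡ x
            × addZ q (lookup (vec u) y) (oneZ q) ≡ lookup (vec v) y

  _⇔'_ : Set → Set → Set
  A ⇔' B = (A → B) × (B → A)

  record Automorphism : Set where
    field
      f       : U → U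
      f⁻¹     : U → U
      left    : ∀ u → f⁻¹ (f u) ≡ u
      right   : ∀ u → f (f⁻¹ u) ≡ u
      presRE  : ∀ c u v → RE c u v ⇔' RE c (f u) (f v)
      presPre : ∀ u v → Pre u v ⇔' Pre (f u) (f v)
      presI   : ∀ x y → T (adj x y) → ∀ u v → I x y u v ⇔' I x y (f u) (f v)
      presC   : ∀ x y → T (adj x y) → ∀ u v → C x y u v ⇔' C x y (f u) (f v)

  iter : ℕ → (U → U) → U → U
  iter zero h = id
  iter (suc k) h = h ∘ iter k h

  -- Aut is an abelian 2-group (group operation = composition,
  -- equality of automorphisms = pointwise equality of underlying maps)
  AutAbelian2Group : Set
  AutAbelian2Group =
      (∀ (σ τ : Automorphism) (u : U) →
          Automorphism.f σ (Automorphism.f τ u) ≡ Automorphism.f τ (Automorphism.f σ u))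
    × (∀ (σ : Automorphism) → ∃ λ k → ∀ u → iter (2 ^ k) (Automorphism.f σ) u ≡ u)

module Submission where

-- An automorphism preserves the preorder ⪯, so it induces a strictly monotone, hence
-- trivial, self-map of the chain V: it maps every A_x to itself. Relating u ∈ A_x by
-- R_{E,c} to the zero tuple of A_y along an edge xy shows that it changes the y-entry
-- of u by a constant depending only on x and y (entries off N(x) are 0 anyway). So
-- every automorphism translates all entries by a fixed family in ℤ_{2^q}; such
-- translations commute, and the 2^q-th iterate of each is the identity.

open import Defs
open import Data.Nat using (ℕ; _≥_)
open import Data.Fin using (Fin)
open import Relation.Binary.PropositionalEquality using (_≡_)

open import Algebra.Bundles using (AbelianGroup)
open import Algebra.Structures using (IsAbelianGroup)
import Algebra.Properties.AbelianGroup as AbelianGroupProperties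
import Algebra.Properties.CommutativeSemigroup as CommutativeSemigroupProperties
open import Data.Bool using (Bool; true; false; T; _∧_)
open import Data.Bool.Properties using (T-∧; T-irrelevant)
open import Data.Fin as F using (toℕ; opposite; _≟_)
open import Data.Fin.Properties
  using (toℕ-fromℕ<; toℕ-injective; toℕ<n; toℕ-inject₁; opposite-prop; opposite-involutive; ≤-antisym)
open import Data.Nat as ℕ using (zero; suc; _+_; _*_; _∸_; _%_; NonZero; z≤n; s≤s)
import Data.Nat.Properties as ℕ
open import Data.Nat.DivMod using (_mod_; %-distribˡ-+; m%n%n≡m%n; m<n⇒m%n≡m; m%n≤m; n%n≡0; [m+kn]%n≡m%n)
open import Data.Nat.GeneralisedArithmetic using (fold)
open import Data.Product as Product using (∃; _,_; proj₁; proj₂)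
open import Data.Unit using (tt)
open import Data.Vec using (Vec; foldr; tabulate; lookup; replicate)
open import Data.Vec.Properties using (lookup-replicate; tabulate-cong; tabulate∘lookup)
open import Function using (_∘_; id; Equivalence)
open import Level using (0ℓ)
open import Relation.Nullary using (yes; no)
open import Relation.Nullary.Decidable using (⌊_⌋; toWitness)
open import Relation.Binary.PropositionalEquality
  using (refl; sym; trans; cong; cong₂; subst; subst₂; isEquivalence; module ≡-Reasoning)

module ModularArithmetic (m : ℕ) .{{_ : NonZero m}} where

  infixl 6 _+ₘ_

  _+ₘ_ : Fin m → Fin m → Fin m
  a +ₘ b = (toℕ a + toℕ b) mod m

  0ₘ : Fin m
  0ₘ = 0 mod m

  -ₘ_ : Fin m → Fin m
  -ₘ a = (m ∸ toℕ a) mod m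

  toℕ-+ₘ : ∀ a b → toℕ (a +ₘ b) ≡ (toℕ a + toℕ b) % m
  toℕ-+ₘ a b = toℕ-fromℕ< _

  toℕ-mod : ∀ (a : Fin m) → toℕ a % m ≡ toℕ a
  toℕ-mod a = m<n⇒m%n≡m (toℕ<n a)

  %-absorbˡ : ∀ x y → (x % m + y) % m ≡ (x + y) % m
  %-absorbˡ x y = begin
    (x % m + y) % m          ≡⟨ %-distribˡ-+ (x % m) y m ⟩
    (x % m % m + y % m) % m  ≡⟨ cong (λ w → (w + y % m) % m) (m%n%n≡m%n x m) ⟩
    (x % m + y % m) % m      ≡⟨ %-distribˡ-+ x y m ⟨
    (x + y) % m              ∎
    where open ≡-Reasoning

  +ₘ-comm : ∀ a b → a +ₘ b ≡ b +ₘ a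
  +ₘ-comm a b = toℕ-injective (begin
    toℕ (a +ₘ b)          ≡⟨ toℕ-+ₘ a b ⟩
    (toℕ a + toℕ b) % m   ≡⟨ cong (_% m) (ℕ.+-comm (toℕ a) (toℕ b)) ⟩
    (toℕ b + toℕ a) % m   ≡⟨ toℕ-+ₘ b a ⟨
    toℕ (b +ₘ a)          ∎)
    where open ≡-Reasoning

  toℕ-+ₘ-+ₘ : ∀ a b c → toℕ (a +ₘ b +ₘ c) ≡ (toℕ a + toℕ b + toℕ c) % m
  toℕ-+ₘ-+ₘ a b c = begin
    toℕ (a +ₘ b +ₘ c)                  ≡⟨ toℕ-+ₘ (a +ₘ b) c ⟩
    (toℕ (a +ₘ b) + toℕ c) % m         ≡⟨ cong (λ w → (w + toℕ c) % m) (toℕ-+ₘ a b) ⟩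
    ((toℕ a + toℕ b) % m + toℕ c) % m  ≡⟨ %-absorbˡ (toℕ a + toℕ b) (toℕ c) ⟩
    (toℕ a + toℕ b + toℕ c) % m        ∎
    where open ≡-Reasoning

  +ₘ-assoc : ∀ a b c → a +ₘ b +ₘ c ≡ a +ₘ (b +ₘ c)
  +ₘ-assoc a b c = toℕ-injective (begin
    toℕ (a +ₘ b +ₘ c)                ≡⟨ toℕ-+ₘ-+ₘ a b c ⟩
    (toℕ a + toℕ b + toℕ c) % m      ≡⟨ cong (_% m) (ℕ.+-assoc (toℕ a) (toℕ b) (toℕ c)) ⟩
    (toℕ a + (toℕ b + toℕ c)) % m    ≡⟨ cong (_% m) (ℕ.+-comm (toℕ a) _) ⟩
    (toℕ b + toℕ c + toℕ a) % m      ≡⟨ toℕ-+ₘ-+ₘ b c a ⟨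
    toℕ (b +ₘ c +ₘ a)                ≡⟨ cong toℕ (+ₘ-comm (b +ₘ c) a) ⟩
    toℕ (a +ₘ (b +ₘ c))              ∎)
    where open ≡-Reasoning

  toℕ-0ₘ : toℕ 0ₘ ≡ 0
  toℕ-0ₘ = ℕ.n≤0⇒n≡0 (ℕ.≤-trans (ℕ.≤-reflexive (toℕ-fromℕ< _)) (m%n≤m 0 m))

  +ₘ-identityʳ : ∀ a → a +ₘ 0ₘ ≡ a
  +ₘ-identityʳ a = toℕ-injective (begin
    toℕ (a +ₘ 0ₘ)          ≡⟨ toℕ-+ₘ a 0ₘ ⟩
    (toℕ a + toℕ 0ₘ) % m   ≡⟨ cong (λ w → (toℕ a + w) % m) toℕ-0ₘ ⟩
    (toℕ a + 0) % m        ≡⟨ cong (_% m) (ℕ.+-identityʳ (toℕ a)) ⟩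
    toℕ a % m              ≡⟨ toℕ-mod a ⟩
    toℕ a                  ∎)
    where open ≡-Reasoning

  +ₘ-inverseʳ : ∀ a → a +ₘ -ₘ a ≡ 0ₘ
  +ₘ-inverseʳ a = toℕ-injective (begin
    toℕ (a +ₘ -ₘ a)                    ≡⟨ toℕ-+ₘ a (-ₘ a) ⟩
    (toℕ a + toℕ (-ₘ a)) % m           ≡⟨ cong (λ w → (toℕ a + w) % m) (toℕ-fromℕ< _) ⟩
    (toℕ a + (m ∸ toℕ a) % m) % m      ≡⟨ cong (_% m) (ℕ.+-comm (toℕ a) _) ⟩
    ((m ∸ toℕ a) % m + toℕ a) % m      ≡⟨ %-absorbˡ (m ∸ toℕ a) (toℕ a) ⟩
    (m ∸ toℕ a + toℕ a) % m            ≡⟨ cong (_% m) (ℕ.m∸n+n≡m (ℕ.<⇒≤ (toℕ<n a))) ⟩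
    m % m                              ≡⟨ n%n≡0 m ⟩
    0                                  ≡⟨ toℕ-0ₘ ⟨
    toℕ 0ₘ                             ∎)
    where open ≡-Reasoning

  +ₘ-isAbelianGroup : IsAbelianGroup _≡_ _+ₘ_ 0ₘ -ₘ_
  +ₘ-isAbelianGroup = record
    { isGroup = record
      { isMonoid = record
        { isSemigroup = record
          { isMagma = record { isEquivalence = isEquivalence ; ∙-cong = cong₂ _+ₘ_ }
          ; assoc = +ₘ-assoc
          }
        ; identity = (λ a → trans (+ₘ-comm 0ₘ a) (+ₘ-identityʳ a)) , +ₘ-identityʳ
        }
      ; inverse = (λ a → trans (+ₘ-comm (-ₘ a) a) (+ₘ-inverseʳ a)) , +ₘ-inverseʳ
      ; ⁻¹-cong = cong -ₘ_
      }
    ; comm = +ₘ-comm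
    }

  +ₘ-abelianGroup : AbelianGroup 0ℓ 0ℓ
  +ₘ-abelianGroup = record { isAbelianGroup = +ₘ-isAbelianGroup }

  toℕ-fold-+ₘ : ∀ a e k → toℕ (fold a (_+ₘ e) k) ≡ (toℕ a + k * toℕ e) % m
  toℕ-fold-+ₘ a e zero = sym (trans (cong (_% m) (ℕ.+-identityʳ (toℕ a))) (toℕ-mod a))
  toℕ-fold-+ₘ a e (suc k) = begin
    toℕ (fold a (_+ₘ e) k +ₘ e)                    ≡⟨ toℕ-+ₘ _ e ⟩
    (toℕ (fold a (_+ₘ e) k) + toℕ e) % m           ≡⟨ cong (λ w → (w + toℕ e) % m) (toℕ-fold-+ₘ a e k) ⟩
    ((toℕ a + k * toℕ e) % m + toℕ e) % m          ≡⟨ %-absorbˡ (toℕ a + k * toℕ e) (toℕ e) ⟩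
    (toℕ a + k * toℕ e + toℕ e) % m                ≡⟨ cong (_% m) (ℕ.+-assoc (toℕ a) _ _) ⟩
    (toℕ a + (k * toℕ e + toℕ e)) % m              ≡⟨ cong (λ w → (toℕ a + w) % m) (ℕ.+-comm (k * toℕ e) (toℕ e)) ⟩
    (toℕ a + suc k * toℕ e) % m                    ∎
    where open ≡-Reasoning

  fold-+ₘ-modulus : ∀ a e → fold a (_+ₘ e) m ≡ a
  fold-+ₘ-modulus a e = toℕ-injective (begin
    toℕ (fold a (_+ₘ e) m)      ≡⟨ toℕ-fold-+ₘ a e m ⟩
    (toℕ a + m * toℕ e) % m     ≡⟨ cong (λ w → (toℕ a + w) % m) (ℕ.*-comm m (toℕ e)) ⟩
    (toℕ a + toℕ e * m) % m     ≡⟨ [m+kn]%n≡m%n (toℕ a) (toℕ e) m ⟩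
    toℕ a % m                   ≡⟨ toℕ-mod a ⟩
    toℕ a                       ∎)
    where open ≡-Reasoning

module _ {N : ℕ} where
  open F using (_<_; _≤_)

  opposite-< : ∀ {i j : Fin N} → i < j → opposite j < opposite i
  opposite-< {i} {j} i<j rewrite opposite-prop i | opposite-prop j = ℕ.∸-monoʳ-< (s≤s i<j) (toℕ<n j)

  opposite-≤⁻¹ : ∀ {i j : Fin N} → opposite i ≤ opposite j → j ≤ i
  opposite-≤⁻¹ {i} {j} oi≤oj = ℕ.≮⇒≥ (λ i<j → ℕ.<⇒≱ (opposite-< i<j) oi≤oj)

  strictMono⇒inflationary : (h : Fin N → Fin N) → (∀ {i j} → i < j → h i < h j) → ∀ i → i ≤ h i
  strictMono⇒inflationary h mono i = go (toℕ i) i refl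
    where
    go : ∀ k i → toℕ i ≡ k → k ℕ.≤ toℕ (h i)
    go zero i _ = z≤n
    go (suc k) (F.suc i) i≡k =
      ℕ.≤-<-trans (go k (F.inject₁ i) (trans (toℕ-inject₁ i) (ℕ.suc-injective i≡k)))
                  (mono (s≤s (ℕ.≤-reflexive (toℕ-inject₁ i))))

  strictMono⇒≗id : (h : Fin N → Fin N) → (∀ {i j} → i < j → h i < h j) → ∀ i → h i ≡ i
  strictMono⇒≗id h mono i = ≤-antisym h[i]≤i (strictMono⇒inflationary h mono i)
    where
    -- the conjugate of h by the order reversal is strictly monotone as well
    h[i]≤i : h i ≤ i
    h[i]≤i = opposite-≤⁻¹ (subst (λ j → opposite i ≤ opposite (h j)) (opposite-involutive i)
               (strictMono⇒inflationary (opposite ∘ h ∘ opposite) (opposite-< ∘ mono ∘ opposite-<) (opposite i)))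

T-foldr-∧-tabulate⁻ : ∀ {k} {P : Fin k → Bool} → T (foldr _ _∧_ true (tabulate P)) → ∀ i → T (P i)
T-foldr-∧-tabulate⁻ {P = P} all F.zero    = proj₁ (Equivalence.to (T-∧ {P F.zero}) all)
T-foldr-∧-tabulate⁻ {P = P} all (F.suc i) = T-foldr-∧-tabulate⁻ (proj₂ (Equivalence.to (T-∧ {P F.zero}) all)) i

foldr-∧-tabulate≡false : ∀ {k} {P : Fin k → Bool} → foldr _ _∧_ true (tabulate P) ≡ false → ∃ λ i → P i ≡ false
foldr-∧-tabulate≡false {suc k} {P} all≡false with P F.zero in P0≡
... | false = F.zero , P0≡
... | true  = Product.map F.suc id (foldr-∧-tabulate≡false all≡false)

lookup-extensionality : ∀ {A : Set} {k} {a b : Vec A k} → (∀ i → lookup a i ≡ lookup b i) → a ≡ b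
lookup-extensionality {a = a} {b} a≗b = trans (sym (tabulate∘lookup a)) (trans (tabulate-cong a≗b) (tabulate∘lookup b))

module CFI-Translations {n : ℕ} (G : BaseGraph n) (q : ℕ) (g : Fin n → Fin n → Zq q) where
  open BaseGraph G using (adj)
  open CFI G q g
  open ModularArithmetic (Mod q) {{ℕ.m^n≢0 2 q}}
  open AbelianGroupProperties +ₘ-abelianGroup using (x≈z//y; //-rightDividesˡ; ε⁻¹≈ε)
  open CommutativeSemigroupProperties (AbelianGroup.commutativeSemigroup +ₘ-abelianGroup) using (xy∙z≈xz∙y)

  -- The neighbourhood test inside `valid` uses a where-bound disjunction that cannot be
  -- named here, so instead of proving each test we refute a failing one.
  valid-intro : ∀ x a → sumZ q a ≡ 0ₘ → (∀ y → adj x y ≡ false → lookup a y ≡ 0ₘ) → T (valid x a)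
  valid-intro x a sum≡0 outside≡0 with valid x a in valid≡
  ... | true = tt
  ... | false with sumZ q a ≟ 0ₘ | valid≡
  ...   | no sum≢0 | _ = sum≢0 sum≡0
  ...   | yes _ | tests≡false with foldr-∧-tabulate≡false tests≡false
  ...     | y , test≡false with adj x y in x≁y | lookup a y ≟ 0ₘ | test≡false
  ...       | false | no a[y]≢0 | _ = a[y]≢0 (outside≡0 y x≁y)

  sum-replicate-0ₘ : ∀ k → sumZ q (replicate k 0ₘ) ≡ 0ₘ
  sum-replicate-0ₘ zero    = refl
  sum-replicate-0ₘ (suc k) = trans (cong (0ₘ +ₘ_) (sum-replicate-0ₘ k)) (+ₘ-identityʳ 0ₘ)

  origin : Fin n → U
  origin x = x , replicate n 0ₘ , valid-intro x (replicate n 0ₘ) (sum-replicate-0ₘ n) (λ y _ → lookup-replicate y 0ₘ)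

  U-≡ : ∀ {u v : U} → vert u ≡ vert v → (∀ y → lookup (vec u) y ≡ lookup (vec v) y) → u ≡ v
  U-≡ {x , a , _} {.x , b , _} refl a≗b with refl ← lookup-extensionality {a = a} {b} a≗b = cong (λ t → x , a , t) (T-irrelevant _ _)

  outside≡0 : ∀ (u : U) y → adj (vert u) y ≡ false → lookup (vec u) y ≡ 0ₘ
  outside≡0 (x , a , valid-xa) y x≁y
    with adj x y | x≁y | T-foldr-∧-tabulate⁻ (proj₂ (Equivalence.to (T-∧ {⌊ sumZ q a ≟ 0ₘ ⌋}) valid-xa)) y
  ... | false | refl | a[y]≡0 = toWitness a[y]≡0

  record IsTranslation (F : U → U) : Set where
    field
      shift          : Fin n → Fin n → Zq q
      vert-fixed     : ∀ u → vert (F u) ≡ vert u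
      lookup-shifted : ∀ u y → lookup (vec (F u)) y ≡ lookup (vec u) y +ₘ shift (vert u) y

  translations-commute : ∀ {φ ψ} → IsTranslation φ → IsTranslation ψ → ∀ u → φ (ψ u) ≡ ψ (φ u)
  translations-commute {φ} {ψ} φ-tr ψ-tr u = U-≡ vert-φψ≡vert-ψφ (λ y → begin
    lookup (vec (φ (ψ u))) y                ≡⟨ Φ.lookup-shifted (ψ u) y ⟩
    lookup (vec (ψ u)) y +ₘ Φ.shift (vert (ψ u)) y
                                            ≡⟨ cong₂ (λ a x → a +ₘ Φ.shift x y) (Ψ.lookup-shifted u y) (Ψ.vert-fixed u) ⟩
    lookup (vec u) y +ₘ Ψ.shift (vert u) y +ₘ Φ.shift (vert u) y
                                            ≡⟨ xy∙z≈xz∙y _ _ _ ⟩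
    lookup (vec u) y +ₘ Φ.shift (vert u) y +ₘ Ψ.shift (vert u) y
                                            ≡⟨ cong₂ (λ a x → a +ₘ Ψ.shift x y) (Φ.lookup-shifted u y) (Φ.vert-fixed u) ⟨
    lookup (vec (φ u)) y +ₘ Ψ.shift (vert (φ u)) y
                                            ≡⟨ Ψ.lookup-shifted (φ u) y ⟨
    lookup (vec (ψ (φ u))) y                ∎)
    where
    module Φ = IsTranslation φ-tr
    module Ψ = IsTranslation ψ-tr
    open ≡-Reasoning
    vert-φψ≡vert-ψφ : vert (φ (ψ u)) ≡ vert (ψ (φ u))
    vert-φψ≡vert-ψφ = trans (trans (Φ.vert-fixed (ψ u)) (Ψ.vert-fixed u)) (sym (trans (Ψ.vert-fixed (φ u)) (Φ.vert-fixed u)))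

  module _ {φ} (φ-tr : IsTranslation φ) where
    open IsTranslation φ-tr

    vert-iter : ∀ k u → vert (iter k φ u) ≡ vert u
    vert-iter zero    u = refl
    vert-iter (suc k) u = trans (vert-fixed (iter k φ u)) (vert-iter k u)

    lookup-iter : ∀ k u y → lookup (vec (iter k φ u)) y ≡ fold (lookup (vec u) y) (_+ₘ shift (vert u) y) k
    lookup-iter zero    u y = refl
    lookup-iter (suc k) u y = trans (lookup-shifted (iter k φ u) y)
      (cong₂ (λ a x → a +ₘ shift x y) (lookup-iter k u y) (vert-iter k u))

    iter-modulus : ∀ u → iter (Mod q) φ u ≡ u
    iter-modulus u = U-≡ (vert-iter (Mod q) u) (λ y → trans (lookup-iter (Mod q) u y) (fold-+ₘ-modulus _ _))

  module _ (σ : Automorphism) where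
    open Automorphism σ

    vert-respects-≡ : ∀ {u v} → vert u ≡ vert v → vert (f u) ≡ vert (f v)
    vert-respects-≡ {u} {v} u≡v =
      ≤-antisym (proj₁ (presPre u v) (ℕ.≤-reflexive (cong toℕ u≡v))) (proj₁ (presPre v u) (ℕ.≤-reflexive (cong toℕ (sym u≡v))))

    vertexMap : Fin n → Fin n
    vertexMap x = vert (f (origin x))

    vertexMap-strictMono : ∀ {x y} → x F.< y → vertexMap x F.< vertexMap y
    vertexMap-strictMono {x} {y} x<y = ℕ.≰⇒> (λ fy≤fx → ℕ.<⇒≱ x<y (proj₂ (presPre (origin y) (origin x)) fy≤fx))

    vert-fixed : ∀ u → vert (f u) ≡ vert u
    vert-fixed u = trans (vert-respects-≡ {u} {origin (vert u)} refl) (strictMono⇒≗id vertexMap vertexMap-strictMono (vert u))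

    shift : Fin n → Fin n → Zq q
    shift x y = -ₘ lookup (vec (f (origin y))) x

    lookup-shifted : ∀ u y → lookup (vec (f u)) y ≡ lookup (vec u) y +ₘ shift (vert u) y
    lookup-shifted u y with adj (vert u) y in x∼y
    ... | false = begin
      lookup (vec (f u)) y      ≡⟨ outside≡0 (f u) y (trans (cong (λ x → adj x y) (vert-fixed u)) x∼y) ⟩
      0ₘ                        ≡⟨ +ₘ-identityʳ 0ₘ ⟨
      0ₘ +ₘ 0ₘ                  ≡⟨ cong (0ₘ +ₘ_) ε⁻¹≈ε ⟨
      0ₘ +ₘ -ₘ 0ₘ               ≡⟨ cong₂ (λ a b → a +ₘ -ₘ b) (outside≡0 u y x∼y) y-origin[x]≡0 ⟨
      lookup (vec u) y +ₘ shift (vert u) y ∎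
      where
      open ≡-Reasoning
      y-origin[x]≡0 : lookup (vec (f (origin y))) (vert u) ≡ 0ₘ
      y-origin[x]≡0 = outside≡0 (f (origin y)) (vert u)
        (trans (cong (λ z → adj z (vert u)) (vert-fixed (origin y))) (trans (BaseGraph.sym G y (vert u)) x∼y))
    ... | true = trans (x≈z//y _ _ _ fu∼fo) (cong (_+ₘ shift x y) c+g≡u[y])
      where
      x : Fin n
      x = vert u
      c : Zq q
      c = lookup (vec u) y +ₘ -ₘ g x y
      c+g≡u[y] : c +ₘ g x y ≡ lookup (vec u) y
      c+g≡u[y] = //-rightDividesˡ (g x y) (lookup (vec u) y)
      u∼o : RE c u (origin y)
      u∼o = subst T (sym x∼y) tt
          , trans (cong (lookup (vec u) y +ₘ_) (lookup-replicate x 0ₘ)) (trans (+ₘ-identityʳ _) (sym c+g≡u[y]))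
      fu∼fo : lookup (vec (f u)) y +ₘ lookup (vec (f (origin y))) x ≡ c +ₘ g x y
      fu∼fo = subst₂ (λ x′ y′ → lookup (vec (f u)) y′ +ₘ lookup (vec (f (origin y))) x′ ≡ c +ₘ g x′ y′)
                (vert-fixed u) (vert-fixed (origin y)) (proj₂ (proj₁ (presRE c u (origin y)) u∼o))

    automorphism-isTranslation : IsTranslation f
    automorphism-isTranslation = record { shift = shift ; vert-fixed = vert-fixed ; lookup-shifted = lookup-shifted }

mainTheorem16 : ∀ {n : ℕ} (G : BaseGraph n) (q : ℕ) → q ≥ 1 →
    (g : Fin n → Fin n → Zq q) → (∀ x y → g x y ≡ g y x) →
    CFI.AutAbelian2Group G q g
mainTheorem16 G q _ g _ =
    (λ σ τ → translations-commute (automorphism-isTranslation σ) (automorphism-isTranslation τ))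
  , (λ σ → q , iter-modulus (automorphism-isTranslation σ))
  where open CFI-Translations G q g
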